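{- Let $v$, $k$ and $\lambda$ be positive integers such that $3 \leq k < v$, let $\mathcal{D}$ be a $(v,k,\lambda)$-covering or -packing on point set $[v]$, and let $G$ be the excess or leave of $\mathcal{D}$. If there is a subset $S$ of $[v]$ and positive real numbers $(c_u)_{u\in S}$ such that, for each $u \in S$, $$\sum_{w \in S \setminus \{u\}} c_w\mu_{G}(uw) < c_u(r_{\mathcal{D}}(u) - \lambda),$$ then $\mathcal{D}$ has at least $|S|$ blocks.
   Context: A $(v,k,\lambda)$-covering (resp. packing) is a pair $([v],\mathcal{B})$ where $\mathcal{B}$ is a collection of $k$-subsets of $[v]=\{1,\dots,v\}$ (blocks) such that every pair of distinct points lies together in at least (resp. at most) $\lambda$ blocks. For $u\in[v]$, $r_{\mathcal{D}}(u)$ is the number of blocks containing $u$, and for distinct $u,w$, $r_{\mathcal{D}}(uw)$ is the number of blocks containing both. The excess (for a covering) or leave (for a packing) of $\mathcal{D}$ is the loopless multigraph $G$ on $[v]$ in which edge $uw$ has multiplicity $\mu_G(uw)=|r_{\mathcal{D}}(uw)-\lambda|$.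
   Formalization: The weights $c_u$ are positive rationals rather than positive reals. -}

module Defs where

open import Data.Nat as ℕ using (ℕ; _≤_; ∣_-_∣)
open import Data.Integer using (+_)
open import Data.Fin using (Fin; _≟_)
open import Data.Fin.Subset using (Subset; ∣_∣)
open import Data.Fin.Subset.Properties using (_∈?_)
open import Data.List using (List; length; filter; allFin; foldr; map)
open import Data.List.Relation.Unary.All using (All)
open import Data.Product using (_×_)
open import Data.Sum using (_⊎_)
open import Relation.Nullary using (¬_)
open import Relation.Nullary.Decidable using (_×-dec_; ¬?)
open import Relation.Binary.PropositionalEquality using (_≡_)
open import Data.Rational as ℚ using (ℚ; 0ℚ)

-- A design on the point set [v] = Fin v is a finite list (multiset) of
-- blocks, each block a subset of Fin v.

r : ∀ {v} → List (Subset v) → Fin v → ℕ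
r B u = length (filter (λ b → u ∈? b) B)

r₂ : ∀ {v} → List (Subset v) → Fin v → Fin v → ℕ
r₂ B u w = length (filter (λ b → (u ∈? b) ×-dec (w ∈? b)) B)

Uniform : ∀ {v} → ℕ → List (Subset v) → Set
Uniform k B = All (λ b → ∣ b ∣ ≡ k) B

IsCovering : (v k lam : ℕ) → List (Subset v) → Set
IsCovering v k lam B =
  Uniform k B × (∀ (u w : Fin v) → ¬ (u ≡ w) → lam ≤ r₂ B u w)

IsPacking : (v k lam : ℕ) → List (Subset v) → Set
IsPacking v k lam B =
  Uniform k B × (∀ (u w : Fin v) → ¬ (u ≡ w) → r₂ B u w ≤ lam)

-- multiplicity of edge uw in the excess / leave G
μ : ∀ {v} → ℕ → List (Subset v) → Fin v → Fin v → ℕ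
μ lam B u w = ∣ r₂ B u w - lam ∣

ℕ→ℚ : ℕ → ℚ
ℕ→ℚ n = + n ℚ./ 1

sumℚ : ∀ {A : Set} → (A → ℚ) → List A → ℚ
sumℚ f xs = foldr ℚ._+_ 0ℚ (map f xs)

S∖ : ∀ {v} → Subset v → Fin v → List (Fin v)
S∖ {v} S u = filter (λ w → (w ∈? S) ×-dec ¬? (w ≟ u)) (allFin v)

{-# OPTIONS --safe #-}
-- Let N be the point–block incidence matrix. If B had fewer than ∣S∣ blocks, there would be a
-- nonzero y supported on S with Nᵀ x = 0 for x = c ⊙ y, hence xᵀ (N Nᵀ) x = 0. Off the diagonal
-- N Nᵀ is λ ± (the adjacency matrix of G), with + for an excess and − for a leave, and its
-- diagonal is r; so xᵀ (N Nᵀ) x = λ (Σ x)² + Σᵤ (r u − λ) x u² ± xᵀ G x. The hypothesis says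
-- that diag(r − λ) ± G is diagonally dominant on S with weights c, which makes the sum of the
-- last two terms positive: a contradiction.
module Submission where

open import Defs
open import Data.Nat using (ℕ; _≤_; _<_)
open import Data.Fin using (Fin)
open import Data.Fin.Subset using (Subset; _∈_; ∣_∣)
open import Data.List using (List; length)
open import Data.Sum using (_⊎_; inj₁; inj₂)
open import Data.Rational using (ℚ; 0ℚ; _*_; _-_) renaming (_<_ to _<ℚ_)

open import Algebra.Bundles using (CommutativeRing)
open import Data.Bool using (if_then_else_)
open import Data.Fin using (zero; suc; _≟_)
import Data.Fin.Properties as Fin
open import Data.Fin.Subset using (_∉_; _⊆_; inside; outside)
open import Data.Fin.Subset.Properties using (_∈?_; nonempty?; Empty-unique; ∣⊥∣≡0)
import Data.Integer as ℤ
import Data.Integer.Properties as ℤ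
open import Data.List using ([]; _∷_; filter; allFin; tabulate; map)
open import Data.List.Properties using (length-map)
open import Data.List.Relation.Unary.All using (All; []; _∷_)
import Data.List.Relation.Unary.All as All
open import Data.List.Relation.Unary.All.Properties using (map⁻)
import Data.Nat as ℕ
import Data.Nat.Properties as ℕ
open import Data.Product using (_×_; _,_)
open import Data.Rational
  using (1ℚ; _+_; -_; 1/_; NonZero; ≢-nonZero; nonNegative; nonPositive; positive; negative)
  renaming (_≤_ to _≤ℚ_)
import Data.Rational as ℚ
import Data.Rational.Properties as ℚ
open import Data.Rational.Solver using (module +-*-Solver)
open import Data.Rational.Unnormalised as ℚᵘ using (ℚᵘ; mkℚᵘ; *≡*)
import Data.Rational.Unnormalised.Properties as ℚᵘ
open import Data.Vec using (_∷_; here; there)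
open import Function using (_∘_)
open import Relation.Binary.Definitions using (tri<; tri≈; tri>)
open import Relation.Binary.PropositionalEquality
open import Relation.Nullary using (Dec; yes; no; does; ¬_; contradiction)
open import Relation.Nullary.Decidable using (_×-dec_; ¬?)
open import Relation.Unary using (Decidable)

open import Algebra.Properties.Semiring.Sum (CommutativeRing.semiring ℚ.+-*-commutativeRing)
  using (sum; sum-syntax; sum-cong-≗; ∑-distrib-+; ∑-comm; *-distribˡ-sum; *-distribʳ-sum)
open +-*-Solver using (solve; _:+_; _:*_; :-_; _:-_; _:=_; con)

ℕ→ℚ-homo-+ : ∀ m n → ℕ→ℚ (m ℕ.+ n) ≡ ℕ→ℚ m + ℕ→ℚ n
ℕ→ℚ-homo-+ m n = ℚ.toℚᵘ-injective (begin
  ℚ.toℚᵘ (ℕ→ℚ (m ℕ.+ n))                   ≈⟨ ℚ.toℚᵘ-fromℚᵘ (ℕ→ℚᵘ (m ℕ.+ n)) ⟩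
  ℕ→ℚᵘ (m ℕ.+ n)                            ≈⟨ *≡* (cong (λ i → i ℤ.* ℤ.+ 1) ℕ→ℤ-homo) ⟩
  ℕ→ℚᵘ m ℚᵘ.+ ℕ→ℚᵘ n                        ≈⟨ ℚᵘ.+-cong (ℚ.toℚᵘ-fromℚᵘ (ℕ→ℚᵘ m)) (ℚ.toℚᵘ-fromℚᵘ (ℕ→ℚᵘ n)) ⟨
  ℚ.toℚᵘ (ℕ→ℚ m) ℚᵘ.+ ℚ.toℚᵘ (ℕ→ℚ n)      ≈⟨ ℚ.toℚᵘ-homo-+ (ℕ→ℚ m) (ℕ→ℚ n) ⟨
  ℚ.toℚᵘ (ℕ→ℚ m + ℕ→ℚ n)                   ∎)
  where
  open ℚᵘ.≃-Reasoning
  ℕ→ℚᵘ : ℕ → ℚᵘ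
  ℕ→ℚᵘ k = mkℚᵘ (ℤ.+ k) 0
  ℕ→ℤ-homo : ℤ.+ (m ℕ.+ n) ≡ ℤ.+ m ℤ.* ℤ.+ 1 ℤ.+ ℤ.+ n ℤ.* ℤ.+ 1
  ℕ→ℤ-homo = trans (ℤ.pos-+ m n) (sym (cong₂ ℤ._+_ (ℤ.*-identityʳ (ℤ.+ m)) (ℤ.*-identityʳ (ℤ.+ n))))

ℕ→ℚ-nonNeg : ∀ n → 0ℚ ≤ℚ ℕ→ℚ n
ℕ→ℚ-nonNeg n = ℚ.nonNegative⁻¹ _ {{ℚ.normalize-nonNeg n 1}}

0≤p*q : ∀ {p q} → 0ℚ ≤ℚ p → 0ℚ ≤ℚ q → 0ℚ ≤ℚ p * q
0≤p*q {p} {q} 0≤p 0≤q =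
  ℚ.nonNegative⁻¹ _ {{ℚ.nonNeg*nonNeg⇒nonNeg p {{nonNegative 0≤p}} q {{nonNegative 0≤q}}}}

0<p*q : ∀ {p q} → 0ℚ <ℚ p → 0ℚ <ℚ q → 0ℚ <ℚ p * q
0<p*q {p} {q} 0<p 0<q = ℚ.positive⁻¹ _ {{ℚ.pos*pos⇒pos p {{positive 0<p}} q {{positive 0<q}}}}

0≤p*p : ∀ p → 0ℚ ≤ℚ p * p
0≤p*p p with ℚ.≤-total 0ℚ p
... | inj₁ 0≤p = 0≤p*q 0≤p 0≤p
... | inj₂ p≤0 = ℚ.nonNegative⁻¹ _ {{ℚ.nonPos*nonPos⇒nonPos p {{nonPositive p≤0}} p {{nonPositive p≤0}}}}

0<p*p : ∀ {p} → p ≢ 0ℚ → 0ℚ <ℚ p * p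
0<p*p {p} p≢0 with ℚ.<-cmp p 0ℚ
... | tri< p<0 _ _ = ℚ.positive⁻¹ _ {{ℚ.neg*neg⇒pos p {{negative p<0}} p {{negative p<0}}}}
... | tri≈ _ p≡0 _ = contradiction p≡0 p≢0
... | tri> _ _ 0<p = 0<p*q 0<p 0<p

*-nonZero : ∀ {p q} → p ≢ 0ℚ → q ≢ 0ℚ → p * q ≢ 0ℚ
*-nonZero {p} {q} p≢0 q≢0 pq≡0 = q≢0 (begin
  q                ≡⟨ ℚ.*-identityˡ q ⟨
  1ℚ * q           ≡⟨ cong (_* q) (ℚ.*-inverseˡ p) ⟨
  (1/ p * p) * q   ≡⟨ ℚ.*-assoc (1/ p) p q ⟩
  1/ p * (p * q)   ≡⟨ cong (1/ p *_) pq≡0 ⟩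
  1/ p * 0ℚ        ≡⟨ ℚ.*-zeroʳ (1/ p) ⟩
  0ℚ               ∎)
  where
  open ≡-Reasoning
  instance
    _ : NonZero p
    _ = ≢-nonZero p≢0

0≤p+p⇒0≤p : ∀ {p} → 0ℚ ≤ℚ p + p → 0ℚ ≤ℚ p
0≤p+p⇒0≤p {p} 0≤p+p with ℚ.<-cmp p 0ℚ
... | tri< p<0 _ _ = contradiction (ℚ.≤-<-trans 0≤p+p (ℚ.+-mono-< p<0 p<0)) (ℚ.<-irrefl refl)
... | tri≈ _ p≡0 _ = ℚ.≤-reflexive (sym p≡0)
... | tri> _ _ 0<p = ℚ.<⇒≤ 0<p

p<q⇒0<q-p : ∀ {p q} → p <ℚ q → 0ℚ <ℚ q - p
p<q⇒0<q-p {p} {q} p<q = subst (_<ℚ q - p) (ℚ.+-inverseʳ p) (ℚ.+-monoˡ-< (- p) p<q)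

∑-nonNeg : ∀ {n} {f : Fin n → ℚ} → (∀ i → 0ℚ ≤ℚ f i) → 0ℚ ≤ℚ ∑[ i < n ] f i
∑-nonNeg {ℕ.zero}  _   = ℚ.≤-refl
∑-nonNeg {ℕ.suc n} 0≤f = ℚ.+-mono-≤ (0≤f zero) (∑-nonNeg (0≤f ∘ suc))

∑-pos : ∀ {n} {f : Fin n → ℚ} → (∀ i → 0ℚ ≤ℚ f i) → ∀ j → 0ℚ <ℚ f j → 0ℚ <ℚ ∑[ i < n ] f i
∑-pos 0≤f zero    0<fj = ℚ.+-mono-<-≤ 0<fj (∑-nonNeg (0≤f ∘ suc))
∑-pos 0≤f (suc j) 0<fj = ℚ.+-mono-≤-< (0≤f zero) (∑-pos (0≤f ∘ suc) j 0<fj)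

∑-zero : ∀ {n} {f : Fin n → ℚ} → (∀ i → f i ≡ 0ℚ) → ∑[ i < n ] f i ≡ 0ℚ
∑-zero {ℕ.zero}  _     = refl
∑-zero {ℕ.suc n} f≡0 = cong₂ _+_ (f≡0 zero) (∑-zero (f≡0 ∘ suc))

∑-concentrated : ∀ {n} {f : Fin n → ℚ} i → (∀ j → j ≢ i → f j ≡ 0ℚ) → ∑[ j < n ] f j ≡ f i
∑-concentrated {f = f} zero f≡0 =
  trans (cong (f zero +_) (∑-zero (λ j → f≡0 (suc j) λ ()))) (ℚ.+-identityʳ (f zero))
∑-concentrated {f = f} (suc i) f≡0 =
  trans (cong₂ _+_ (f≡0 zero λ ()) (∑-concentrated i (λ j j≢i → f≡0 (suc j) (j≢i ∘ Fin.suc-injective))))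
        (ℚ.+-identityˡ (f (suc i)))

∑∑-product : ∀ {n} (p q : Fin n → ℚ) → ∑[ u < n ] ∑[ w < n ] (p u * q w) ≡ (∑[ u < n ] p u) * (∑[ w < n ] q w)
∑∑-product p q = trans (sum-cong-≗ (λ u → sym (*-distribˡ-sum (p u) q))) (sym (*-distribʳ-sum (sum q) p))

∑∑-distrib-+ : ∀ {n} (f g : Fin n → Fin n → ℚ) →
  ∑[ u < n ] ∑[ w < n ] (f u w + g u w) ≡ ∑[ u < n ] ∑[ w < n ] f u w + ∑[ u < n ] ∑[ w < n ] g u w
∑∑-distrib-+ {n} f g = trans (sum-cong-≗ λ u → ∑-distrib-+ (f u) (g u))
                             (∑-distrib-+ (λ u → ∑[ w < n ] f u w) (λ u → ∑[ w < n ] g u w))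

restrict : ∀ {A : Set} {P : A → Set} → Decidable P → (A → ℚ) → A → ℚ
restrict P? f a = if does (P? a) then f a else 0ℚ

restrict-∈ : ∀ {A : Set} {P : A → Set} (P? : Decidable P) {f : A → ℚ} {a} → P a → restrict P? f a ≡ f a
restrict-∈ P? {a = a} Pa with P? a
... | yes _  = refl
... | no ¬Pa = contradiction Pa ¬Pa

restrict-∉ : ∀ {A : Set} {P : A → Set} (P? : Decidable P) {f : A → ℚ} {a} → ¬ P a → restrict P? f a ≡ 0ℚ
restrict-∉ P? {a = a} ¬Pa with P? a
... | yes Pa = contradiction Pa ¬Pa
... | no  _  = refl

sumℚ-filter : ∀ {A : Set} {P : A → Set} (P? : Decidable P) (f : A → ℚ) xs →
              sumℚ f (filter P? xs) ≡ sumℚ (restrict P? f) xs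
sumℚ-filter P? f []       = refl
sumℚ-filter P? f (a ∷ xs) with P? a
... | yes _ = cong (f a +_) (sumℚ-filter P? f xs)
... | no  _ = trans (sumℚ-filter P? f xs) (sym (ℚ.+-identityˡ _))

sumℚ-tabulate : ∀ {A : Set} {n} (f : A → ℚ) (g : Fin n → A) → sumℚ f (tabulate g) ≡ ∑[ i < n ] f (g i)
sumℚ-tabulate {n = ℕ.zero}  f g = refl
sumℚ-tabulate {n = ℕ.suc n} f g = cong (f (g zero) +_) (sumℚ-tabulate f (g ∘ suc))

-- Underdetermined homogeneous linear systems

-- Data.Fin.Subset._-_ goes through a where-bound helper closed over both arguments, which
-- blocks induction on the subset; hence this direct definition.
_∖_ : ∀ {n} → Subset n → Fin n → Subset n
(_ ∷ p) ∖ zero  = outside ∷ p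
(s ∷ p) ∖ suc x = s ∷ (p ∖ x)

x∉p∖x : ∀ {n} (p : Subset n) x → x ∉ p ∖ x
x∉p∖x (_ ∷ p) zero    ()
x∉p∖x (_ ∷ p) (suc x) (there x∈p∖x) = x∉p∖x p x x∈p∖x

p∖x⊆p : ∀ {n} (p : Subset n) x → p ∖ x ⊆ p
p∖x⊆p (_ ∷ p) zero    (there w∈p)   = there w∈p
p∖x⊆p (_ ∷ p) (suc x) here          = here
p∖x⊆p (_ ∷ p) (suc x) (there w∈p∖x) = there (p∖x⊆p p x w∈p∖x)

∣p∣≤1+∣p∖x∣ : ∀ {n} (p : Subset n) x → ∣ p ∣ ≤ ℕ.suc ∣ p ∖ x ∣
∣p∣≤1+∣p∖x∣ (inside  ∷ p) zero    = ℕ.≤-refl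
∣p∣≤1+∣p∖x∣ (outside ∷ p) zero    = ℕ.n≤1+n _
∣p∣≤1+∣p∖x∣ (inside  ∷ p) (suc x) = ℕ.s≤s (∣p∣≤1+∣p∖x∣ p x)
∣p∣≤1+∣p∖x∣ (outside ∷ p) (suc x) = ∣p∣≤1+∣p∖x∣ p x

infix 8 _·_

_·_ : ∀ {n} → (Fin n → ℚ) → (Fin n → ℚ) → ℚ
_·_ {n} e y = ∑[ w < n ] (e w * y w)

𝟙 : ∀ {n} → Subset n → Fin n → ℚ
𝟙 b = restrict (_∈? b) (λ _ → 1ℚ)

·-combination : ∀ {n} (f y z : Fin n → ℚ) a b → f · (λ w → a * y w + b * z w) ≡ a * (f · y) + b * (f · z)
·-combination {n} f y z a b = trans (sum-cong-≗ λ w → distrib (f w) (y w) (z w) a b)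
  (trans (∑-distrib-+ (λ w → a * (f w * y w)) (λ w → b * (f w * z w)))
         (sym (cong₂ _+_ (*-distribˡ-sum a (λ w → f w * y w)) (*-distribˡ-sum b (λ w → f w * z w)))))
  where
  distrib : ∀ c s t a b → c * (a * s + b * t) ≡ a * (c * s) + b * (c * t)
  distrib = solve 5 (λ c s t a b → c :* (a :* s :+ b :* t) := a :* (c :* s) :+ b :* (c :* t)) refl

record NontrivialSolution {n} (E : List (Fin n → ℚ)) (L : Subset n) : Set where
  field
    y         : Fin n → ℚ
    supported : ∀ w → w ∉ L → y w ≡ 0ℚ
    point     : Fin n
    nonzero   : y point ≢ 0ℚ
    solves    : All (λ e → e · y ≡ 0ℚ) E

solution-[] : ∀ {n} {L : Subset n} → 0 < ∣ L ∣ → NontrivialSolution [] L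
solution-[] {n} {L} 0<∣L∣ with nonempty? L
... | yes (u , u∈L) = record
  { y         = 𝟙 L
  ; supported = λ w → restrict-∉ (_∈? L)
  ; point     = u
  ; nonzero   = ℚ.1≢0 ∘ trans (sym (restrict-∈ (_∈? L) u∈L))
  ; solves    = []
  }
... | no L-empty = contradiction (subst (0 <_) (trans (cong ∣_∣ (Empty-unique L-empty)) (∣⊥∣≡0 n)) 0<∣L∣)
                                 (ℕ.<-irrefl refl)

module _ {n : ℕ} {e : Fin n → ℚ} {E : List (Fin n → ℚ)} {L : Subset n}
         (sol₁ : NontrivialSolution E L) (sol₂ : NontrivialSolution E (L ∖ NontrivialSolution.point sol₁)) where

  open NontrivialSolution sol₁ renaming (y to y₁; supported to supported₁; nonzero to nonzero₁; solves to solves₁)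
  open NontrivialSolution sol₂ using ()
    renaming (y to y₂; supported to supported₂; point to point₂; nonzero to nonzero₂; solves to solves₂)

  solution-∷-second : e · y₂ ≡ 0ℚ → NontrivialSolution (e ∷ E) L
  solution-∷-second e·y₂≡0 = record
    { y = y₂ ; supported = λ w w∉L → supported₂ w (w∉L ∘ p∖x⊆p L point)
    ; point = point₂ ; nonzero = nonzero₂ ; solves = e·y₂≡0 ∷ solves₂ }

  solution-∷-combined : e · y₂ ≢ 0ℚ → NontrivialSolution (e ∷ E) L
  solution-∷-combined e·y₂≢0 = record
    { y = y ; supported = supported ; point = point ; nonzero = nonzero
    ; solves = e·y≡0 ∷ All.map (λ {f} → f·y≡0 {f}) (All.zip (solves₁ , solves₂)) }
    where
    a b : ℚ
    a = e · y₂
    b = - (e · y₁)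

    y : Fin n → ℚ
    y w = a * y₁ w + b * y₂ w

    supported : ∀ w → w ∉ L → y w ≡ 0ℚ
    supported w w∉L = trans (cong₂ (λ s t → a * s + b * t) (supported₁ w w∉L) (supported₂ w (w∉L ∘ p∖x⊆p L point)))
                            (cong₂ _+_ (ℚ.*-zeroʳ a) (ℚ.*-zeroʳ b))

    nonzero : y point ≢ 0ℚ
    nonzero = *-nonZero e·y₂≢0 nonzero₁ ∘ trans (sym y≡ay₁)
      where
      y≡ay₁ : y point ≡ a * y₁ point
      y≡ay₁ = trans (cong (λ t → a * y₁ point + b * t) (supported₂ point (x∉p∖x L point)))
                    (trans (cong (a * y₁ point +_) (ℚ.*-zeroʳ b)) (ℚ.+-identityʳ (a * y₁ point)))

    e·y≡0 : e · y ≡ 0ℚ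
    e·y≡0 = trans (·-combination e y₁ y₂ a b) (cancel (e · y₂) (e · y₁))
      where
      cancel : ∀ s t → s * t + (- t) * s ≡ 0ℚ
      cancel = solve 2 (λ s t → s :* t :+ (:- t) :* s := con 0ℚ) refl

    f·y≡0 : ∀ {f} → f · y₁ ≡ 0ℚ × f · y₂ ≡ 0ℚ → f · y ≡ 0ℚ
    f·y≡0 {f} (f·y₁≡0 , f·y₂≡0) = trans (·-combination f y₁ y₂ a b)
      (trans (cong₂ (λ s t → a * s + b * t) f·y₁≡0 f·y₂≡0) (cong₂ _+_ (ℚ.*-zeroʳ a) (ℚ.*-zeroʳ b)))

  solution-∷ : NontrivialSolution (e ∷ E) L
  solution-∷ with e · y₂ ℚ.≟ 0ℚ
  ... | yes e·y₂≡0 = solution-∷-second e·y₂≡0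
  ... | no  e·y₂≢0 = solution-∷-combined e·y₂≢0

-- Solving the remaining equations twice, the second time away from a point where the first
-- solution is nonzero, gives two solutions a suitable combination of which solves the first
-- equation too.
underdetermined⇒nontrivialSolution : ∀ {n} (E : List (Fin n → ℚ)) L → length E < ∣ L ∣ → NontrivialSolution E L
underdetermined⇒nontrivialSolution []      L 0<∣L∣   = solution-[] 0<∣L∣
underdetermined⇒nontrivialSolution {n} (e ∷ E) L ∣E∣<∣L∣ = solution-∷ sol₁ sol₂
  where
  sol₁ : NontrivialSolution E L
  sol₁ = underdetermined⇒nontrivialSolution E L (ℕ.<-trans (ℕ.n<1+n _) ∣E∣<∣L∣)
  p : Fin n
  p = NontrivialSolution.point sol₁
  sol₂ : NontrivialSolution E (L ∖ p)
  sol₂ = underdetermined⇒nontrivialSolution E (L ∖ p) (ℕ.≤-pred (ℕ.≤-trans ∣E∣<∣L∣ (∣p∣≤1+∣p∖x∣ L p)))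

-- Quadratic forms

quadForm : ∀ {n} → (Fin n → Fin n → ℚ) → (Fin n → ℚ) → ℚ
quadForm {n} a x = ∑[ u < n ] ∑[ w < n ] (a u w * (x u * x w))

module _ {n : ℕ} (x : Fin n → ℚ) where

  quadForm-cong : ∀ {a b : Fin n → Fin n → ℚ} → (∀ u w → a u w ≡ b u w) → quadForm a x ≡ quadForm b x
  quadForm-cong a≡b = sum-cong-≗ λ u → sum-cong-≗ λ w → cong (_* (x u * x w)) (a≡b u w)

  quadForm-+ : ∀ (a b : Fin n → Fin n → ℚ) → quadForm (λ u w → a u w + b u w) x ≡ quadForm a x + quadForm b x
  quadForm-+ a b = trans (sum-cong-≗ λ u → sum-cong-≗ λ w → ℚ.*-distribʳ-+ (x u * x w) (a u w) (b u w))
                         (∑∑-distrib-+ (λ u w → a u w * (x u * x w)) (λ u w → b u w * (x u * x w)))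

  quadForm-* : ∀ k (a : Fin n → Fin n → ℚ) → quadForm (λ u w → k * a u w) x ≡ k * quadForm a x
  quadForm-* k a = begin
    ∑[ u < n ] ∑[ w < n ] (k * a u w * (x u * x w))
      ≡⟨ sum-cong-≗ (λ u → sum-cong-≗ λ w → ℚ.*-assoc k (a u w) (x u * x w)) ⟩
    ∑[ u < n ] ∑[ w < n ] (k * (a u w * (x u * x w)))
      ≡⟨ sum-cong-≗ (λ u → *-distribˡ-sum k (λ w → a u w * (x u * x w))) ⟨
    ∑[ u < n ] (k * ∑[ w < n ] (a u w * (x u * x w)))
      ≡⟨ *-distribˡ-sum k (λ u → ∑[ w < n ] (a u w * (x u * x w))) ⟨
    k * quadForm a x ∎
    where open ≡-Reasoning

  quadForm-outer : ∀ (p : Fin n → ℚ) → quadForm (λ u w → p u * p w) x ≡ (p · x) * (p · x)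
  quadForm-outer p = trans (sum-cong-≗ λ u → sum-cong-≗ λ w → interchange (p u) (p w) (x u) (x w))
                           (∑∑-product (λ u → p u * x u) (λ w → p w * x w))
    where
    interchange : ∀ a b c d → a * b * (c * d) ≡ a * c * (b * d)
    interchange = solve 4 (λ a b c d → a :* b :* (c :* d) := a :* c :* (b :* d)) refl

  quadForm-offDiagonal : ∀ (a b : Fin n → Fin n → ℚ) →
    (∀ u w → u ≢ w → a u w * (x u * x w) ≡ b u w * (x u * x w)) →
    quadForm a x ≡ quadForm b x + ∑[ u < n ] ((a u u - b u u) * (x u * x u))
  quadForm-offDiagonal a b agree = begin
    quadForm a x                                                     ≡⟨ quadForm-cong split ⟩
    quadForm (λ u w → b u w + (a u w - b u w)) x                     ≡⟨ quadForm-+ b (λ u w → a u w - b u w) ⟩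
    quadForm b x + quadForm (λ u w → a u w - b u w) x                ≡⟨ cong (quadForm b x +_) (sum-cong-≗ diagonal) ⟩
    quadForm b x + ∑[ u < n ] ((a u u - b u u) * (x u * x u))        ∎
    where
    open ≡-Reasoning
    split : ∀ u w → a u w ≡ b u w + (a u w - b u w)
    split u w = solve 2 (λ a b → a := b :+ (a :- b)) refl (a u w) (b u w)
    diagonal : ∀ u → ∑[ w < n ] ((a u w - b u w) * (x u * x w)) ≡ (a u u - b u u) * (x u * x u)
    diagonal u = ∑-concentrated u λ w w≢u → begin
      (a u w - b u w) * (x u * x w)                       ≡⟨ ℚ.*-distribʳ-+ (x u * x w) (a u w) (- b u w) ⟩
      a u w * (x u * x w) + (- b u w) * (x u * x w)       ≡⟨ cong (_+ (- b u w) * (x u * x w)) (agree u w (w≢u ∘ sym)) ⟩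
      b u w * (x u * x w) + (- b u w) * (x u * x w)       ≡⟨ ℚ.*-distribʳ-+ (x u * x w) (b u w) (- b u w) ⟨
      (b u w - b u w) * (x u * x w)                       ≡⟨ cong (_* (x u * x w)) (ℚ.+-inverseʳ (b u w)) ⟩
      0ℚ * (x u * x w)                                    ≡⟨ ℚ.*-zeroˡ (x u * x w) ⟩
      0ℚ                                                  ∎

quadForm-const-nonNeg : ∀ {n} {k} (x : Fin n → ℚ) → 0ℚ ≤ℚ k → 0ℚ ≤ℚ quadForm (λ _ _ → k) x
quadForm-const-nonNeg {k = k} x 0≤k = subst (0ℚ ≤ℚ_) (sym constForm) (0≤p*q 0≤k (0≤p*p ((λ _ → 1ℚ) · x)))
  where
  constForm : quadForm (λ _ _ → k) x ≡ k * ((λ _ → 1ℚ) · x * ((λ _ → 1ℚ) · x))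
  constForm = trans (quadForm-cong x (λ _ _ → sym (ℚ.*-identityʳ k)))
                    (trans (quadForm-* x k (λ _ _ → 1ℚ)) (cong (k *_) (quadForm-outer x (λ _ → 1ℚ))))

module _ {v : ℕ} where

  pairCount : List (Subset v) → Fin v → Fin v → ℚ
  pairCount B u w = ℕ→ℚ (r₂ B u w)

  pairCount-∷ : ∀ b B u w → pairCount (b ∷ B) u w ≡ 𝟙 b u * 𝟙 b w + pairCount B u w
  pairCount-∷ b B u w with u ∈? b | w ∈? b
  ... | yes _ | yes _ = ℕ→ℚ-homo-+ 1 (r₂ B u w)
  ... | yes _ | no  _ = sym (ℚ.+-identityˡ _)
  ... | no  _ | yes _ = sym (ℚ.+-identityˡ _)
  ... | no  _ | no  _ = sym (ℚ.+-identityˡ _)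

  r₂-diagonal : ∀ (B : List (Subset v)) u → r₂ B u u ≡ r B u
  r₂-diagonal []      u = refl
  r₂-diagonal (b ∷ B) u with u ∈? b
  ... | yes _ = cong ℕ.suc (r₂-diagonal B u)
  ... | no  _ = r₂-diagonal B u

  r₂-sym : ∀ (B : List (Subset v)) u w → r₂ B u w ≡ r₂ B w u
  r₂-sym []      u w = refl
  r₂-sym (b ∷ B) u w with u ∈? b | w ∈? b
  ... | yes _ | yes _ = cong ℕ.suc (r₂-sym B u w)
  ... | yes _ | no  _ = r₂-sym B u w
  ... | no  _ | yes _ = r₂-sym B u w
  ... | no  _ | no  _ = r₂-sym B u w

  -- xᵀ (N Nᵀ) x = Σ_b (𝟙 b · x)² for the incidence matrix N.
  quadForm-pairCount : ∀ {B : List (Subset v)} {x} → All (λ b → 𝟙 b · x ≡ 0ℚ) B → quadForm (pairCount B) x ≡ 0ℚ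
  quadForm-pairCount {x = x} [] = ∑-zero λ u → ∑-zero λ w → ℚ.*-zeroˡ (x u * x w)
  quadForm-pairCount {b ∷ B} {x} (b·x≡0 ∷ B·x≡0) = begin
    quadForm (pairCount (b ∷ B)) x                                         ≡⟨ quadForm-cong x (pairCount-∷ b B) ⟩
    quadForm (λ u w → 𝟙 b u * 𝟙 b w + pairCount B u w) x                  ≡⟨ quadForm-+ x (λ u w → 𝟙 b u * 𝟙 b w) (pairCount B) ⟩
    quadForm (λ u w → 𝟙 b u * 𝟙 b w) x + quadForm (pairCount B) x          ≡⟨ cong₂ _+_ (quadForm-outer x (𝟙 b)) (quadForm-pairCount B·x≡0) ⟩
    (𝟙 b · x) * (𝟙 b · x) + 0ℚ                                             ≡⟨ cong (λ t → t * t + 0ℚ) b·x≡0 ⟩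
    0ℚ                                                                     ∎
    where open ≡-Reasoning

-- Weighted diagonal dominance

module WeightedDominance {n : ℕ} (m : Fin n → Fin n → ℚ) (c y : Fin n → ℚ)
  (m-sym : ∀ u w → m u w ≡ m w u) (m-nonNeg : ∀ u w → 0ℚ ≤ℚ m u w * (c u * c w)) where

  x : Fin n → ℚ
  x u = c u * y u

  rowWeight : Fin n → ℚ
  rowWeight u = ∑[ w < n ] (c w * m u w)

  weightedRows : ℚ
  weightedRows = ∑[ u < n ] (c u * (y u * y u) * rowWeight u)

  weightedRows-∑∑ : ∑[ u < n ] ∑[ w < n ] (m u w * (c u * c w) * (y u * y u)) ≡ weightedRows
  weightedRows-∑∑ = sum-cong-≗ λ u → begin
    ∑[ w < n ] (m u w * (c u * c w) * (y u * y u))   ≡⟨ sum-cong-≗ (λ w → regroup (m u w) (c u) (c w) (y u)) ⟩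
    ∑[ w < n ] (c u * (y u * y u) * (c w * m u w))   ≡⟨ *-distribˡ-sum (c u * (y u * y u)) (λ w → c w * m u w) ⟨
    c u * (y u * y u) * rowWeight u                  ∎
    where
    open ≡-Reasoning
    regroup : ∀ a cu cw yu → a * (cu * cw) * (yu * yu) ≡ cu * (yu * yu) * (cw * a)
    regroup = solve 4 (λ a cu cw yu → a :* (cu :* cw) :* (yu :* yu) := cu :* (yu :* yu) :* (cw :* a)) refl

  weightedRows-∑∑ᵀ : ∑[ u < n ] ∑[ w < n ] (m u w * (c u * c w) * (y w * y w)) ≡ weightedRows
  weightedRows-∑∑ᵀ = trans (∑-comm (λ u w → m u w * (c u * c w) * (y w * y w)))
    (trans (sum-cong-≗ λ w → sum-cong-≗ λ u → cong₂ (λ a b → a * b * (y w * y w)) (m-sym u w) (ℚ.*-comm (c u) (c w)))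
           weightedRows-∑∑)

  module _ (σ : ℚ) (σ²≡1 : σ * σ ≡ 1ℚ) where

    square-terms : ∀ u w → m u w * (c u * c w) * ((y u + σ * y w) * (y u + σ * y w))
      ≡ (m u w * (c u * c w) * (y u * y u) + (σ * m u w * (x u * x w) + σ * m u w * (x u * x w)))
        + m u w * (c u * c w) * (y w * y w)
    square-terms u w = trans (expand (m u w) (c u) (c w) (y u) (y w) σ)
      (cong (m u w * (c u * c w) * (y u * y u) + (σ * m u w * (x u * x w) + σ * m u w * (x u * x w)) +_)
            (trans (cong (_* (m u w * (c u * c w) * (y w * y w))) σ²≡1) (ℚ.*-identityˡ _)))
      where
      expand : ∀ a cu cw yu yw s → a * (cu * cw) * ((yu + s * yw) * (yu + s * yw))
        ≡ (a * (cu * cw) * (yu * yu) + (s * a * (cu * yu * (cw * yw)) + s * a * (cu * yu * (cw * yw))))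
          + (s * s) * (a * (cu * cw) * (yw * yw))
      expand = solve 6 (λ a cu cw yu yw s → a :* (cu :* cw) :* ((yu :+ s :* yw) :* (yu :+ s :* yw))
        := (a :* (cu :* cw) :* (yu :* yu) :+ (s :* a :* (cu :* yu :* (cw :* yw)) :+ s :* a :* (cu :* yu :* (cw :* yw))))
           :+ (s :* s) :* (a :* (cu :* cw) :* (yw :* yw))) refl

    ∑∑-weightedSquares : ∑[ u < n ] ∑[ w < n ] (m u w * (c u * c w) * ((y u + σ * y w) * (y u + σ * y w)))
                         ≡ (weightedRows + σ * quadForm m x) + (weightedRows + σ * quadForm m x)
    ∑∑-weightedSquares = begin
      ∑[ u < n ] ∑[ w < n ] (m u w * (c u * c w) * ((y u + σ * y w) * (y u + σ * y w)))
        ≡⟨ sum-cong-≗ (λ u → sum-cong-≗ (square-terms u)) ⟩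
      ∑[ u < n ] ∑[ w < n ] ((A u w * (y u * y u) + (S u w + S u w)) + A u w * (y w * y w))
        ≡⟨ ∑∑-distrib-+ (λ u w → A u w * (y u * y u) + (S u w + S u w)) (λ u w → A u w * (y w * y w)) ⟩
      ∑[ u < n ] ∑[ w < n ] (A u w * (y u * y u) + (S u w + S u w)) + ∑[ u < n ] ∑[ w < n ] (A u w * (y w * y w))
        ≡⟨ cong₂ _+_ (trans (∑∑-distrib-+ (λ u w → A u w * (y u * y u)) (λ u w → S u w + S u w))
                            (cong₂ _+_ weightedRows-∑∑ (∑∑-distrib-+ S S)))
                     weightedRows-∑∑ᵀ ⟩
      (weightedRows + (quadForm (λ u w → σ * m u w) x + quadForm (λ u w → σ * m u w) x)) + weightedRows
        ≡⟨ cong (λ t → (weightedRows + (t + t)) + weightedRows) (quadForm-* x σ m) ⟩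
      (weightedRows + (σ * quadForm m x + σ * quadForm m x)) + weightedRows
        ≡⟨ regroup weightedRows (σ * quadForm m x) ⟩
      (weightedRows + σ * quadForm m x) + (weightedRows + σ * quadForm m x) ∎
      where
      open ≡-Reasoning
      A S : Fin n → Fin n → ℚ
      A u w = m u w * (c u * c w)
      S u w = σ * m u w * (x u * x w)
      regroup : ∀ t q → (t + (q + q)) + t ≡ (t + q) + (t + q)
      regroup = solve 2 (λ t q → (t :+ (q :+ q)) :+ t := (t :+ q) :+ (t :+ q)) refl

    quadForm-bound : 0ℚ ≤ℚ weightedRows + σ * quadForm m x
    quadForm-bound = 0≤p+p⇒0≤p (subst (0ℚ ≤ℚ_) ∑∑-weightedSquares
      (∑-nonNeg λ u → ∑-nonNeg λ w → 0≤p*q (m-nonNeg u w) (0≤p*p (y u + σ * y w))))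

    dominance⇒positive : (d : Fin n → ℚ) →
      (∀ u → y u ≢ 0ℚ → 0ℚ <ℚ c u × rowWeight u <ℚ c u * d u) → ∀ u₀ → y u₀ ≢ 0ℚ →
      0ℚ <ℚ ∑[ u < n ] (d u * (x u * x u)) + σ * quadForm m x
    dominance⇒positive d dominant u₀ yu₀≢0 =
      subst (0ℚ <ℚ_) (sym split) (ℚ.+-mono-<-≤ (∑-pos 0≤surplus u₀ (0<surplus u₀ yu₀≢0)) quadForm-bound)
      where
      surplus : Fin n → ℚ
      surplus u = c u * (y u * y u) * (c u * d u - rowWeight u)

      0<surplus : ∀ u → y u ≢ 0ℚ → 0ℚ <ℚ surplus u
      0<surplus u yu≢0 = let 0<cu , R<cd = dominant u yu≢0 in 0<p*q (0<p*q 0<cu (0<p*p yu≢0)) (p<q⇒0<q-p R<cd)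

      0≤surplus : ∀ u → 0ℚ ≤ℚ surplus u
      0≤surplus u with y u ℚ.≟ 0ℚ
      ... | yes yu≡0 = ℚ.≤-reflexive (sym (trans (cong (λ t → c u * (t * t) * (c u * d u - rowWeight u)) yu≡0)
                                                 (vanish (c u) (c u * d u - rowWeight u))))
        where
        vanish : ∀ a b → a * (0ℚ * 0ℚ) * b ≡ 0ℚ
        vanish = solve 2 (λ a b → a :* (con 0ℚ :* con 0ℚ) :* b := con 0ℚ) refl
      ... | no  yu≢0 = ℚ.<⇒≤ (0<surplus u yu≢0)

      split : ∑[ u < n ] (d u * (x u * x u)) + σ * quadForm m x ≡ ∑[ u < n ] surplus u + (weightedRows + σ * quadForm m x)
      split = begin
        ∑[ u < n ] (d u * (x u * x u)) + σ * quadForm m x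
          ≡⟨ cong (_+ σ * quadForm m x) (sum-cong-≗ λ u → regroup (c u) (y u) (d u) (rowWeight u)) ⟩
        ∑[ u < n ] (surplus u + c u * (y u * y u) * rowWeight u) + σ * quadForm m x
          ≡⟨ cong (_+ σ * quadForm m x) (∑-distrib-+ surplus (λ u → c u * (y u * y u) * rowWeight u)) ⟩
        (∑[ u < n ] surplus u + weightedRows) + σ * quadForm m x
          ≡⟨ ℚ.+-assoc (sum surplus) weightedRows (σ * quadForm m x) ⟩
        ∑[ u < n ] surplus u + (weightedRows + σ * quadForm m x) ∎
        where
        open ≡-Reasoning
        regroup : ∀ cu yu du R → du * (cu * yu * (cu * yu)) ≡ cu * (yu * yu) * (cu * du - R) + cu * (yu * yu) * R
        regroup = solve 4 (λ cu yu du R → du :* (cu :* yu :* (cu :* yu))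
                            := cu :* (yu :* yu) :* (cu :* du :- R) :+ cu :* (yu :* yu) :* R) refl

module _ {v : ℕ} (lam : ℕ) (B : List (Subset v)) where

  μℚ : Fin v → Fin v → ℚ
  μℚ u w = ℕ→ℚ (μ lam B u w)

  μℚ-sym : ∀ u w → μℚ u w ≡ μℚ w u
  μℚ-sym u w = cong (λ t → ℕ→ℚ ℕ.∣ t - lam ∣) (r₂-sym B u w)

  covering-pairCount : ∀ u w → lam ≤ r₂ B u w → pairCount B u w ≡ ℕ→ℚ lam + 1ℚ * μℚ u w
  covering-pairCount u w lam≤r₂ = begin
    ℕ→ℚ (r₂ B u w)                      ≡⟨ cong ℕ→ℚ (ℕ.m+[n∸m]≡n lam≤r₂) ⟨
    ℕ→ℚ (lam ℕ.+ (r₂ B u w ℕ.∸ lam))    ≡⟨ ℕ→ℚ-homo-+ lam (r₂ B u w ℕ.∸ lam) ⟩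
    ℕ→ℚ lam + ℕ→ℚ (r₂ B u w ℕ.∸ lam)    ≡⟨ cong (λ t → ℕ→ℚ lam + ℕ→ℚ t) (ℕ.m≤n⇒∣n-m∣≡n∸m lam≤r₂) ⟨
    ℕ→ℚ lam + μℚ u w                    ≡⟨ cong (ℕ→ℚ lam +_) (ℚ.*-identityˡ (μℚ u w)) ⟨
    ℕ→ℚ lam + 1ℚ * μℚ u w               ∎
    where open ≡-Reasoning

  packing-pairCount : ∀ u w → r₂ B u w ≤ lam → pairCount B u w ≡ ℕ→ℚ lam + (- 1ℚ) * μℚ u w
  packing-pairCount u w r₂≤lam = begin
    pairCount B u w                                ≡⟨ move (pairCount B u w) (μℚ u w) ⟩
    (pairCount B u w + μℚ u w) + (- 1ℚ) * μℚ u w   ≡⟨ cong (_+ (- 1ℚ) * μℚ u w) r₂+μ≡lam ⟩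
    ℕ→ℚ lam + (- 1ℚ) * μℚ u w                      ∎
    where
    open ≡-Reasoning
    move : ∀ a b → a ≡ (a + b) + (- 1ℚ) * b
    move = solve 2 (λ a b → a := (a :+ b) :+ (:- con 1ℚ) :* b) refl
    r₂+μ≡lam : pairCount B u w + μℚ u w ≡ ℕ→ℚ lam
    r₂+μ≡lam = begin
      ℕ→ℚ (r₂ B u w) + ℕ→ℚ (μ lam B u w)            ≡⟨ ℕ→ℚ-homo-+ (r₂ B u w) (μ lam B u w) ⟨
      ℕ→ℚ (r₂ B u w ℕ.+ ℕ.∣ r₂ B u w - lam ∣)      ≡⟨ cong (λ t → ℕ→ℚ (r₂ B u w ℕ.+ t)) (ℕ.∣-∣-comm (r₂ B u w) lam) ⟩
      ℕ→ℚ (r₂ B u w ℕ.+ ℕ.∣ lam - r₂ B u w ∣)      ≡⟨ cong (λ t → ℕ→ℚ (r₂ B u w ℕ.+ t)) (ℕ.m≤n⇒∣n-m∣≡n∸m r₂≤lam) ⟩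
      ℕ→ℚ (r₂ B u w ℕ.+ (lam ℕ.∸ r₂ B u w))        ≡⟨ cong ℕ→ℚ (ℕ.m+[n∸m]≡n r₂≤lam) ⟩
      ℕ→ℚ lam                                      ∎

module BlockBound {v : ℕ} (lam : ℕ) (B : List (Subset v)) (σ : ℚ) (σ²≡1 : σ * σ ≡ 1ℚ)
  (deviation : ∀ u w → u ≢ w → pairCount B u w ≡ ℕ→ℚ lam + σ * μℚ lam B u w)
  (S : Subset v) (c : Fin v → ℚ) (c-pos : ∀ u → u ∈ S → 0ℚ <ℚ c u) where

  distinctIn? : ∀ u w → Dec (u ∈ S × w ∈ S × w ≢ u)
  distinctIn? u w = (u ∈? S) ×-dec ((w ∈? S) ×-dec ¬? (w ≟ u))

  μ↾ : Fin v → Fin v → ℚ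
  μ↾ u = restrict (distinctIn? u) (μℚ lam B u)

  μ↾-inside : ∀ {u w} → u ∈ S × w ∈ S × w ≢ u → μ↾ u w ≡ μℚ lam B u w
  μ↾-inside {u} = restrict-∈ (distinctIn? u) {μℚ lam B u}

  μ↾-outside : ∀ {u w} → ¬ (u ∈ S × w ∈ S × w ≢ u) → μ↾ u w ≡ 0ℚ
  μ↾-outside {u} = restrict-∉ (distinctIn? u) {μℚ lam B u}

  μ↾-sym : ∀ u w → μ↾ u w ≡ μ↾ w u
  μ↾-sym u w = by-cases (distinctIn? u w)
    where
    by-cases : Dec (u ∈ S × w ∈ S × w ≢ u) → μ↾ u w ≡ μ↾ w u
    by-cases (yes (u∈S , w∈S , w≢u)) = trans (μ↾-inside (u∈S , w∈S , w≢u))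
      (trans (μℚ-sym lam B u w) (sym (μ↾-inside (w∈S , u∈S , w≢u ∘ sym))))
    by-cases (no ¬distinct) = trans (μ↾-outside ¬distinct)
      (sym (μ↾-outside λ (w∈S , u∈S , u≢w) → ¬distinct (u∈S , w∈S , u≢w ∘ sym)))

  μ↾-weighted-nonNeg : ∀ u w → 0ℚ ≤ℚ μ↾ u w * (c u * c w)
  μ↾-weighted-nonNeg u w = by-cases (distinctIn? u w)
    where
    by-cases : Dec (u ∈ S × w ∈ S × w ≢ u) → 0ℚ ≤ℚ μ↾ u w * (c u * c w)
    by-cases (yes (u∈S , w∈S , w≢u)) = subst (λ t → 0ℚ ≤ℚ t * (c u * c w)) (sym (μ↾-inside (u∈S , w∈S , w≢u)))
      (0≤p*q (ℕ→ℚ-nonNeg (μ lam B u w)) (ℚ.<⇒≤ (0<p*q (c-pos u u∈S) (c-pos w w∈S))))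
    by-cases (no ¬distinct) = subst (λ t → 0ℚ ≤ℚ t * (c u * c w)) (sym (μ↾-outside ¬distinct))
      (ℚ.≤-reflexive (sym (ℚ.*-zeroˡ (c u * c w))))

  μ↾-rowWeight : ∀ u → u ∈ S → ∑[ w < v ] (c w * μ↾ u w) ≡ sumℚ (λ w → c w * μℚ lam B u w) (S∖ S u)
  μ↾-rowWeight u u∈S = sym (begin
    sumℚ (λ w → c w * μℚ lam B u w) (S∖ S u)         ≡⟨ sumℚ-filter inS∖? (λ w → c w * μℚ lam B u w) (allFin v) ⟩
    sumℚ (restrict inS∖? (λ w → c w * μℚ lam B u w)) (allFin v) ≡⟨ sumℚ-tabulate (restrict inS∖? (λ w → c w * μℚ lam B u w)) (λ w → w) ⟩
    ∑[ w < v ] restrict inS∖? (λ w → c w * μℚ lam B u w) w      ≡⟨ sum-cong-≗ restricted ⟩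
    ∑[ w < v ] (c w * μ↾ u w)                         ∎)
    where
    open ≡-Reasoning
    inS∖? : ∀ w → Dec (w ∈ S × ¬ w ≡ u)
    inS∖? w = (w ∈? S) ×-dec ¬? (w ≟ u)
    restricted : ∀ w → restrict inS∖? (λ w → c w * μℚ lam B u w) w ≡ c w * μ↾ u w
    restricted w = by-cases (inS∖? w)
      where
      by-cases : Dec (w ∈ S × w ≢ u) → restrict inS∖? (λ w → c w * μℚ lam B u w) w ≡ c w * μ↾ u w
      by-cases (yes (w∈S , w≢u)) = trans (restrict-∈ inS∖? {λ w → c w * μℚ lam B u w} (w∈S , w≢u))
        (cong (c w *_) (sym (μ↾-inside (u∈S , w∈S , w≢u))))
      by-cases (no w∉S∖u) = trans (restrict-∉ inS∖? {λ w → c w * μℚ lam B u w} w∉S∖u)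
        (trans (sym (ℚ.*-zeroʳ (c w))) (cong (c w *_) (sym (μ↾-outside λ (_ , w∈S , w≢u) → w∉S∖u (w∈S , w≢u)))))

  weightedBlocks : List (Fin v → ℚ)
  weightedBlocks = map (λ b w → 𝟙 b w * c w) B

  module _ (dominant : ∀ u → u ∈ S → sumℚ (λ w → c w * μℚ lam B u w) (S∖ S u) <ℚ c u * (ℕ→ℚ (r B u) - ℕ→ℚ lam))
    where

    module _ (sol : NontrivialSolution weightedBlocks S) where

      open NontrivialSolution sol
      open WeightedDominance μ↾ c y μ↾-sym μ↾-weighted-nonNeg

      x-outside : ∀ u → u ∉ S → x u ≡ 0ℚ
      x-outside u u∉S = trans (cong (c u *_) (supported u u∉S)) (ℚ.*-zeroʳ (c u))

      y-support : ∀ u → y u ≢ 0ℚ → u ∈ S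
      y-support u yu≢0 with u ∈? S
      ... | yes u∈S = u∈S
      ... | no  u∉S = contradiction (supported u u∉S) yu≢0

      blockSums : All (λ b → 𝟙 b · x ≡ 0ℚ) B
      blockSums = All.map (λ {b} → trans (sum-cong-≗ λ w → sym (ℚ.*-assoc (𝟙 b w) (c w) (y w)))) (map⁻ solves)

      lam±μ↾ : Fin v → Fin v → ℚ
      lam±μ↾ u w = ℕ→ℚ lam + σ * μ↾ u w

      agree : ∀ u w → u ≢ w → pairCount B u w * (x u * x w) ≡ lam±μ↾ u w * (x u * x w)
      agree u w u≢w = by-cases (u ∈? S) (w ∈? S)
        where
        vanishing : x u * x w ≡ 0ℚ → pairCount B u w * (x u * x w) ≡ lam±μ↾ u w * (x u * x w)
        vanishing xx≡0 = trans (cong (pairCount B u w *_) xx≡0)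
          (trans (ℚ.*-zeroʳ (pairCount B u w)) (sym (trans (cong (lam±μ↾ u w *_) xx≡0) (ℚ.*-zeroʳ (lam±μ↾ u w)))))
        by-cases : Dec (u ∈ S) → Dec (w ∈ S) → pairCount B u w * (x u * x w) ≡ lam±μ↾ u w * (x u * x w)
        by-cases (yes u∈S) (yes w∈S) = cong (_* (x u * x w)) (trans (deviation u w u≢w)
          (cong (λ t → ℕ→ℚ lam + σ * t) (sym (μ↾-inside (u∈S , w∈S , u≢w ∘ sym)))))
        by-cases (no u∉S) _ = vanishing (trans (cong (_* x w) (x-outside u u∉S)) (ℚ.*-zeroˡ (x w)))
        by-cases _ (no w∉S) = vanishing (trans (cong (x u *_) (x-outside w w∉S)) (ℚ.*-zeroʳ (x u)))

      d : Fin v → ℚ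
      d u = pairCount B u u - lam±μ↾ u u

      d≡r-lam : ∀ u → d u ≡ ℕ→ℚ (r B u) - ℕ→ℚ lam
      d≡r-lam u = cong₂ _-_ (cong ℕ→ℚ (r₂-diagonal B u)) (begin
        ℕ→ℚ lam + σ * μ↾ u u   ≡⟨ cong (λ t → ℕ→ℚ lam + σ * t) (μ↾-outside λ (_ , _ , u≢u) → u≢u refl) ⟩
        ℕ→ℚ lam + σ * 0ℚ       ≡⟨ cong (ℕ→ℚ lam +_) (ℚ.*-zeroʳ σ) ⟩
        ℕ→ℚ lam + 0ℚ           ≡⟨ ℚ.+-identityʳ (ℕ→ℚ lam) ⟩
        ℕ→ℚ lam                ∎)
        where open ≡-Reasoning

      dominant′ : ∀ u → y u ≢ 0ℚ → 0ℚ <ℚ c u × rowWeight u <ℚ c u * d u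
      dominant′ u yu≢0 = c-pos u u∈S
        , subst₂ _<ℚ_ (sym (μ↾-rowWeight u u∈S)) (cong (c u *_) (sym (d≡r-lam u))) (dominant u u∈S)
        where
        u∈S : u ∈ S
        u∈S = y-support u yu≢0

      form≡0 : quadForm (pairCount B) x ≡ 0ℚ
      form≡0 = quadForm-pairCount blockSums

      form-split : quadForm (pairCount B) x
        ≡ quadForm (λ _ _ → ℕ→ℚ lam) x + (∑[ u < v ] (d u * (x u * x u)) + σ * quadForm μ↾ x)
      form-split = begin
        quadForm (pairCount B) x
          ≡⟨ quadForm-offDiagonal x (pairCount B) lam±μ↾ agree ⟩
        quadForm lam±μ↾ x + ∑[ u < v ] (d u * (x u * x u))
          ≡⟨ cong (_+ ∑[ u < v ] (d u * (x u * x u))) (trans (quadForm-+ x (λ _ _ → ℕ→ℚ lam) (λ u w → σ * μ↾ u w))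
                                                           (cong (quadForm (λ _ _ → ℕ→ℚ lam) x +_) (quadForm-* x σ μ↾))) ⟩
        (quadForm (λ _ _ → ℕ→ℚ lam) x + σ * quadForm μ↾ x) + ∑[ u < v ] (d u * (x u * x u))
          ≡⟨ regroup (quadForm (λ _ _ → ℕ→ℚ lam) x) (σ * quadForm μ↾ x) (∑[ u < v ] (d u * (x u * x u))) ⟩
        quadForm (λ _ _ → ℕ→ℚ lam) x + (∑[ u < v ] (d u * (x u * x u)) + σ * quadForm μ↾ x) ∎
        where
        open ≡-Reasoning
        regroup : ∀ a b c → (a + b) + c ≡ a + (c + b)
        regroup = solve 3 (λ a b c → (a :+ b) :+ c := a :+ (c :+ b)) refl

      0<form : 0ℚ <ℚ quadForm (pairCount B) x
      0<form = subst (0ℚ <ℚ_) (sym form-split)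
        (ℚ.+-mono-≤-< (quadForm-const-nonNeg x (ℕ→ℚ-nonNeg lam)) (dominance⇒positive σ σ²≡1 d dominant′ point nonzero))

    fewerBlocks-impossible : ¬ (length B < ∣ S ∣)
    fewerBlocks-impossible ∣B∣<∣S∣ = ℚ.<-irrefl (sym (form≡0 sol)) (0<form sol)
      where
      sol : NontrivialSolution weightedBlocks S
      sol = underdetermined⇒nontrivialSolution weightedBlocks S
        (subst (_< ∣ S ∣) (sym (length-map (λ b w → 𝟙 b w * c w) B)) ∣B∣<∣S∣)

    ∣S∣≤∣B∣ : ∣ S ∣ ≤ length B
    ∣S∣≤∣B∣ = ℕ.≮⇒≥ fewerBlocks-impossible

lemma3p1 : (v k lam : ℕ) → 1 ≤ lam → 3 ≤ k → k < v →
    (B : List (Subset v)) →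
    (IsCovering v k lam B ⊎ IsPacking v k lam B) →
    (S : Subset v) → (c : Fin v → ℚ) →
    (∀ u → u ∈ S → 0ℚ <ℚ c u) →
    (∀ u → u ∈ S →
      sumℚ (λ w → c w * ℕ→ℚ (μ lam B u w)) (S∖ S u)
        <ℚ c u * (ℕ→ℚ (r B u) - ℕ→ℚ lam)) →
    ∣ S ∣ ≤ length B
lemma3p1 v k lam _ _ _ B (inj₁ (_ , covering)) S c c-pos dominant =
  BlockBound.∣S∣≤∣B∣ lam B 1ℚ refl (λ u w u≢w → covering-pairCount lam B u w (covering u w u≢w)) S c c-pos dominant
lemma3p1 v k lam _ _ _ B (inj₂ (_ , packing)) S c c-pos dominant =
  BlockBound.∣S∣≤∣B∣ lam B (- 1ℚ) refl (λ u w u≢w → packing-pairCount lam B u w (packing u w u≢w)) S c c-pos dominant
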